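{- Let $D$ be an $\mathrm{STS}_2(v)$ on $V=\mathbb{F}_2^v$ which is invariant under the group $\langle A_{v,f}\rangle$, where $f\in\{0,\ldots,v-1\}$ with $v-f$ even. Let $L$ be a $2$-dimensional subspace of $V$ fixed by $\langle A_{v,f}\rangle$. Then the unique block of $D$ containing $L$ is fixed by $\langle A_{v,f}\rangle$.
   Context: An $\mathrm{STS}_2(v)$ (binary $q$-Steiner triple system) on $V=\mathbb{F}_2^v$ is a set $D$ of $3$-dimensional subspaces (blocks) of $V$ such that every $2$-dimensional subspace of $V$ is contained in exactly one block. $A_{v,f}$ is the block-diagonal matrix over $\mathbb{F}_2$ consisting of $\frac{v-f}{2}$ consecutive blocks $\begin{pmatrix}0&1\\1&1\end{pmatrix}$ followed by an $f\times f$ identity matrix; it acts on subspaces via $\mathbf{x}\mapsto\mathbf{x}A_{v,f}$, and $D$ is invariant if it is mapped to itself by this action. -}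

module Defs where

open import Data.Bool using (Bool; true; false; _∧_; _xor_; not; if_then_else_)
open import Data.Nat using (ℕ; zero; suc; _<ᵇ_; _≡ᵇ_; _/_; _%_; _∸_)
open import Data.Fin using (Fin; toℕ)
open import Data.Vec using (Vec; tabulate; lookup; foldr; replicate; zipWith; []; _∷_)
open import Data.Product using (Σ; _×_; _,_)
open import Relation.Binary.PropositionalEquality using (_≡_)

-- Vectors of F₂^v, represented as Bool vectors (xor = addition, ∧ = multiplication).
F2^ : ℕ → Set
F2^ v = Vec Bool v

Matrix : ℕ → Set
Matrix v = Fin v → Fin v → Bool

𝟎 : ∀ {v} → F2^ v
𝟎 = replicate _ false

_⊕_ : ∀ {v} → F2^ v → F2^ v → F2^ v
_⊕_ = zipWith _xor_

_·_ : ∀ {v} → F2^ v → Matrix v → F2^ v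
x · M = tabulate λ j → foldr _ _xor_ false (tabulate λ i → lookup x i ∧ M i j)

-- The matrix A_{v,f}: (v ∸ f)/2 diagonal blocks [[0,1],[1,1]] followed by I_f.
A : (v f : ℕ) → Matrix v
A v f i j =
  let m = v ∸ f ; a = toℕ i ; b = toℕ j in
  if a <ᵇ m
  then (if b <ᵇ m
        then ((a / 2) ≡ᵇ (b / 2)) ∧ not (((a % 2) ≡ᵇ 0) ∧ ((b % 2) ≡ᵇ 0))
        else false)
  else (if b <ᵇ m then false else a ≡ᵇ b)

actPow : ∀ {v} → Matrix v → ℕ → F2^ v → F2^ v
actPow M zero    x = x
actPow M (suc n) x = actPow M n (x · M)

SubsetV : ℕ → Set₁
SubsetV v = F2^ v → Set

_⊆_ : ∀ {v} → SubsetV v → SubsetV v → Set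
S ⊆ T = ∀ x → S x → T x

_≐_ : ∀ {v} → SubsetV v → SubsetV v → Set
S ≐ T = (S ⊆ T) × (T ⊆ S)

lincomb : ∀ {v k} → Vec Bool k → Vec (F2^ v) k → F2^ v
lincomb [] [] = 𝟎
lincomb (c ∷ cs) (b ∷ bs) = (if c then b else 𝟎) ⊕ lincomb cs bs

LinIndep : ∀ {v k} → Vec (F2^ v) k → Set
LinIndep {k = k} bs = ∀ c → lincomb c bs ≡ 𝟎 → c ≡ replicate k false

IsSubspaceOfDim : ∀ {v} → ℕ → SubsetV v → Set
IsSubspaceOfDim {v} k S =
  Σ (Vec (F2^ v) k) λ bs → LinIndep bs × (∀ x → S x → Σ (Vec Bool k) λ c → lincomb c bs ≡ x)
                                       × (∀ c → S (lincomb c bs))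

image : ∀ {v} → Matrix v → ℕ → SubsetV v → SubsetV v
image M n S y = Σ _ λ x → S x × actPow M n x ≡ y

IsSTS2 : ∀ {v} → (SubsetV v → Set) → Set₁
IsSTS2 {v} D =
  (∀ B → D B → IsSubspaceOfDim 3 B) ×
  (∀ L → IsSubspaceOfDim 2 L →
     (Σ (SubsetV v) λ B → D B × L ⊆ B) ×
     (∀ B B′ → D B → D B′ → L ⊆ B → L ⊆ B′ → B ≐ B′))

InvariantUnder : ∀ {v} → Matrix v → ℕ → (SubsetV v → Set) → Set₁
InvariantUnder {v} M n D =
  (∀ B → D B → Σ (SubsetV v) λ B′ → D B′ × B′ ≐ image M n B) ×
  (∀ B′ → D B′ → Σ (SubsetV v) λ B → D B × B′ ≐ image M n B)

-- invariance / fixedness under the cyclic group ⟨M⟩ = { M^n | n ∈ ℕ } (M has finite order)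
InvariantUnderGroup : ∀ {v} → Matrix v → (SubsetV v → Set) → Set₁
InvariantUnderGroup M D = ∀ n → InvariantUnder M n D

FixedByGroup : ∀ {v} → Matrix v → SubsetV v → Set
FixedByGroup M S = ∀ n → image M n S ≐ S

module Submission where

open import Defs
open import Data.Nat using (ℕ; _<_; _∸_)
open import Data.Nat.Divisibility using (_∣_)
open import Data.Product using (_×_; _,_; proj₁; proj₂)
open import Function using (_∘_)

-- The image of the block B is again a block, and it contains the image of L, which is L
-- itself; by uniqueness of the block through L it is B.

≐-sym : ∀ {v} {S T : SubsetV v} → S ≐ T → T ≐ S
≐-sym (S⊆T , T⊆S) = T⊆S , S⊆T

≐-trans : ∀ {v} {R S T : SubsetV v} → R ≐ S → S ≐ T → R ≐ T
≐-trans (R⊆S , S⊆R) (S⊆T , T⊆S) = (λ x → S⊆T x ∘ R⊆S x) , (λ x → S⊆R x ∘ T⊆S x)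

module _ {v : ℕ} (M : Matrix v) (n : ℕ) where

  image-mono : {S T : SubsetV v} → S ⊆ T → image M n S ⊆ image M n T
  image-mono S⊆T y (x , Sx , x↦y) = x , S⊆T x Sx , x↦y

  block-through-fixed-line-fixed :
    {D : SubsetV v → Set} → IsSTS2 D → InvariantUnder M n D →
    {L : SubsetV v} → IsSubspaceOfDim 2 L → image M n L ≐ L →
    {B : SubsetV v} → D B → L ⊆ B → image M n B ≐ B
  block-through-fixed-line-fixed (_ , blockThrough) inv {L} dimL (_ , L⊆imgL) {B} DB L⊆B
    with proj₁ inv B DB
  ... | B′ , DB′ , B′≐imgB = ≐-sym (≐-trans B≐B′ B′≐imgB)
    where
    L⊆B′ : L ⊆ B′
    L⊆B′ x Lx = proj₂ B′≐imgB x (image-mono L⊆B x (L⊆imgL x Lx))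

    B≐B′ : B ≐ B′
    B≐B′ = proj₂ (blockThrough L dimL) B B′ DB DB′ L⊆B L⊆B′

lemma4 : (v f : ℕ) → f < v → 2 ∣ (v ∸ f) →
    (D : SubsetV v → Set) → IsSTS2 D → InvariantUnderGroup (A v f) D →
    (L : SubsetV v) → IsSubspaceOfDim 2 L → FixedByGroup (A v f) L →
    (B : SubsetV v) → D B → L ⊆ B → FixedByGroup (A v f) B
lemma4 v f _ _ D sts inv L dimL fixL B DB L⊆B n =
  block-through-fixed-line-fixed (A v f) n sts (inv n) dimL (fixL n) DB L⊆B
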